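{- For every set of formulas $\Gamma$ and formula $\varphi$: if $\Gamma\vdash_{\mathbf K^p}\varphi$ then $\Gamma\vDash_{\mathcal C_{\mathbf K^p}}\varphi$, and if $\Gamma\vdash_{\mathbf T^p}\varphi$ then $\Gamma\vDash_{\mathcal C_{\mathbf T^p}}\varphi$.
   Context: Fix a countable set $P0$ of propositional variables. Formulas are generated by $\varphi::=p\mid\perp\mid(\varphi\land\varphi)\mid(\varphi\to\varphi)$ with $p\in P0$; $Form$ is the set of formulas; $\land$ is left-associative and binds tighter than $\to$. A model is $\mathfrak M=(W,R,V)$ with $W\neq\emptyset$, $R\subseteq W\times W$, $V:P0\to\wp(W)$. Satisfaction: $\mathfrak M,s\nvDash\perp$; $\mathfrak M,s\vDash p$ iff $s\in V(p)$; $\land$ is pointwise; $\mathfrak M,s\vDash\varphi\to\psi$ iff for every $t$ with $sRt$, $\mathfrak M,t\vDash\varphi$ implies $\mathfrak M,t\vDash\psi$. For $X\subseteq W$: $R[X]=\{t:\exists s\in X,\ sRt\}$, $R^\Box(X)=\{s:\forall t\,(sRt\Rightarrow t\in X)\}$. A proposition of $(W,R)$ is $X\subseteq W$ with $R[X]\cap R^\Box(R[X])\subseteq X$; an interpretation is a model in which every $V(p)$ is a proposition. $\mathcal C_{\mathbf K^p}$ is the class of pointed models $(\mathfrak M,s)$ with $\mathfrak M$ an interpretation; $\mathcal C_{\mathbf T^p}$ the class with $\mathfrak M$ a reflexive interpretation. $\Gamma\vDash_{\mathcal C}\varphi$ means: for every $(\mathfrak M,s)\in\mathcal C$, if $\mathfrak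 M,s$ satisfies all of $\Gamma$ then $\mathfrak M,s\vDash\varphi$. Sequents are pairs $(\Gamma,\varphi)$ with $\Gamma\subseteq Form$; write $\Gamma\vdash\varphi$ for membership, $\psi\vdash\varphi$ for $\{\psi\}\vdash\varphi$, $\vdash\varphi$ for $\emptyset\vdash\varphi$. Rules (universally quantified over $\Gamma,\Delta\subseteq Form$, $p\in P0$, formulas $\varphi,\psi,\chi$): (A) $\Gamma\cup\{\varphi\}\vdash\varphi$; (Mon) $\Gamma\subseteq\Delta$, $\Gamma\vdash\varphi$ imply $\Delta\vdash\varphi$; (Cut) $\Gamma\cup\{\psi\}\vdash\varphi$, $\Delta\vdash\psi$ imply $\Gamma\cup\Delta\vdash\varphi$; ($\perp$) $\perp\vdash\varphi$; ($\land$I) $\{\varphi,\psi\}\vdash\varphi\land\psi$; ($\land$E) $\varphi\land\psi\vdash\varphi$ and $\varphi\land\psi\vdash\psi$; ($\to$0) $\vdash\varphi\to\varphi$; ($\to$1) if $\Gamma\vdash\varphi$ then $\{\psi\to\chi:\chi\in\Gamma\}\vdash\psi\to\varphi$; ($\to$2) $\{\varphi\to\psi,\psi\to\chi\}\vdash\varphi\to\chi$; (Refl) $\{\varphi,\varphi\to\psi\}\vdash\psi$; (Prop$^-$) $p\vdash((\perp\to\perp)\to\perp)\to p$. $\vdash_{\mathbf K^p}$ is the least set of sequents satisfying (A),(Mon),(Cut),($\perp$),($\land$I),($\land$E),($\to$0),($\to$1),($\to$2),(Prop$^-$); $\vdash_{\mathbf T^p}$ is the least set satisfying these together with (Refl).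 -}

module Defs where

open import Data.Nat using (ℕ)
open import Data.Bool using (Bool; true; false)
open import Data.Product using (Σ; _×_; _,_)
open import Data.Sum using (_⊎_)
open import Data.Empty using (⊥)
open import Relation.Binary.PropositionalEquality using (_≡_)

data Form : Set where
  var : ℕ → Form
  ⊥′  : Form
  _∧′_ : Form → Form → Form
  _⇒_ : Form → Form → Form

infixl 7 _∧′_
infixr 6 _⇒_

FSet : Set₁
FSet = Form → Set

_∪_ : FSet → FSet → FSet
(Γ ∪ Δ) φ = Γ φ ⊎ Δ φ

｛_｝ : Form → FSet
｛ φ ｝ ψ = ψ ≡ φ

｛_；_｝ : Form → Form → FSet
｛ φ ； ψ ｝ = ｛ φ ｝ ∪ ｛ ψ ｝

∅ : FSet
∅ _ = ⊥

_⊆_ : FSet → FSet → Set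
Γ ⊆ Δ = ∀ φ → Γ φ → Δ φ

impSet : Form → FSet → FSet
impSet ψ Γ θ = Σ Form (λ χ → Γ χ × (θ ≡ (ψ ⇒ χ)))

propAnte : Form
propAnte = (⊥′ ⇒ ⊥′) ⇒ ⊥′

-- The Bool flag says whether (Refl) is available:
-- Deriv false = ⊢_{K^p},  Deriv true = ⊢_{T^p}.
data Deriv (refl? : Bool) : FSet → Form → Set₁ where
  A    : ∀ Γ φ → Deriv refl? (Γ ∪ ｛ φ ｝) φ
  Mon  : ∀ Γ Δ φ → Γ ⊆ Δ → Deriv refl? Γ φ → Deriv refl? Δ φ
  Cut  : ∀ Γ Δ ψ φ → Deriv refl? (Γ ∪ ｛ ψ ｝) φ → Deriv refl? Δ ψ → Deriv refl? (Γ ∪ Δ) φ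
  Bot  : ∀ φ → Deriv refl? ｛ ⊥′ ｝ φ
  AndI : ∀ φ ψ → Deriv refl? ｛ φ ； ψ ｝ (φ ∧′ ψ)
  AndE₁ : ∀ φ ψ → Deriv refl? ｛ φ ∧′ ψ ｝ φ
  AndE₂ : ∀ φ ψ → Deriv refl? ｛ φ ∧′ ψ ｝ ψ
  Imp0 : ∀ φ → Deriv refl? ∅ (φ ⇒ φ)
  Imp1 : ∀ Γ φ ψ → Deriv refl? Γ φ → Deriv refl? (impSet ψ Γ) (ψ ⇒ φ)
  Imp2 : ∀ φ ψ χ → Deriv refl? ｛ φ ⇒ ψ ； ψ ⇒ χ ｝ (φ ⇒ χ)
  Refl : ∀ φ ψ → refl? ≡ true → Deriv refl? ｛ φ ； φ ⇒ ψ ｝ ψ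
  PropM : ∀ p → Deriv refl? ｛ var p ｝ (propAnte ⇒ var p)

_⊢Kp_ : FSet → Form → Set₁
Γ ⊢Kp φ = Deriv false Γ φ

_⊢Tp_ : FSet → Form → Set₁
Γ ⊢Tp φ = Deriv true Γ φ

record Model : Set₁ where
  field
    W : Set
    inhabited : W
    R : W → W → Set
    V : ℕ → W → Set

open Model public

_⊨_at_ : (M : Model) → Form → W M → Set
M ⊨ var p at s = V M p s
M ⊨ ⊥′ at s = ⊥
M ⊨ (φ ∧′ ψ) at s = (M ⊨ φ at s) × (M ⊨ ψ at s)
M ⊨ (φ ⇒ ψ) at s = ∀ t → R M s t → M ⊨ φ at t → M ⊨ ψ at t

image : {W : Set} → (W → W → Set) → (W → Set) → W → Set
image {W} R X t = Σ W (λ s → X s × R s t)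

boxPre : {W : Set} → (W → W → Set) → (W → Set) → W → Set
boxPre R X s = ∀ t → R s t → X t

IsProposition : {W : Set} → (W → W → Set) → (W → Set) → Set
IsProposition R X = ∀ s → image R X s → boxPre R (image R X) s → X s

IsInterpretation : Model → Set
IsInterpretation M = ∀ p → IsProposition (R M) (V M p)

IsReflexive : Model → Set
IsReflexive M = ∀ s → R M s s

CKp : (M : Model) → W M → Set
CKp M s = IsInterpretation M

CTp : (M : Model) → W M → Set
CTp M s = IsInterpretation M × IsReflexive M

Consequence : ((M : Model) → W M → Set) → FSet → Form → Set₁
Consequence C Γ φ = ∀ (M : Model) (s : W M) → C M s →
  (∀ ψ → Γ ψ → M ⊨ ψ at s) → M ⊨ φ at s

_⊨Kp_ : FSet → Form → Set₁
Γ ⊨Kp φ = Consequence CKp Γ φ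

_⊨Tp_ : FSet → Form → Set₁
Γ ⊨Tp φ = Consequence CTp Γ φ

{-# OPTIONS --safe #-}
module Submission where

open import Defs
open import Data.Bool using (Bool; true; false)
open import Data.Empty using (⊥-elim)
open import Data.Product using (_×_; _,_; proj₁; proj₂)
open import Data.Sum using (inj₁; inj₂)
open import Relation.Nullary using (¬_)
open import Relation.Binary.PropositionalEquality using (refl)

-- The only
-- rule that uses the restriction to interpretations is (Prop⁻): a point satisfying
-- (⊥ → ⊥) → ⊥ has no successors, so R^□(R[X]) holds there vacuously, and a
-- proposition X therefore contains every dead end reachable from X.

_⊨ₛ_at_ : (M : Model) → FSet → W M → Set
M ⊨ₛ Γ at s = ∀ ψ → Γ ψ → M ⊨ ψ at s

Admissible : Bool → Model → Set
Admissible false M = IsInterpretation M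
Admissible true  M = IsInterpretation M × IsReflexive M

admissible⇒interpretation : ∀ b {M} → Admissible b M → IsInterpretation M
admissible⇒interpretation false I       = I
admissible⇒interpretation true  (I , _) = I

⊨propAnte⇒dead-end : ∀ M {t} → M ⊨ propAnte at t → ∀ u → ¬ R M t u
⊨propAnte⇒dead-end M ⊨ante u tu = ⊨ante u tu (λ _ _ ⊥′-at-v → ⊥′-at-v)

proposition-contains-reachable-dead-ends : ∀ {W} {R : W → W → Set} {X : W → Set} →
  IsProposition R X → ∀ {s t} → X s → R s t → (∀ u → ¬ R t u) → X t
proposition-contains-reachable-dead-ends isProp {s} {t} Xs st dead =
  isProp t (s , Xs , st) (λ u tu → ⊥-elim (dead u tu))

sound : ∀ {b Γ φ} → Deriv b Γ φ → Consequence (λ M _ → Admissible b M) Γ φ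
sound (A Γ φ) M s adm ⊨Γ = ⊨Γ φ (inj₂ refl)
sound (Mon Γ Δ φ Γ⊆Δ d) M s adm ⊨Δ = sound d M s adm (λ ψ ψ∈Γ → ⊨Δ ψ (Γ⊆Δ ψ ψ∈Γ))
sound (Cut Γ Δ ψ φ d e) M s adm ⊨Γ∪Δ = sound d M s adm ⊨Γ,ψ
  where
    ⊨Γ,ψ : M ⊨ₛ Γ ∪ ｛ ψ ｝ at s
    ⊨Γ,ψ χ (inj₁ χ∈Γ) = ⊨Γ∪Δ χ (inj₁ χ∈Γ)
    ⊨Γ,ψ χ (inj₂ refl) = sound e M s adm (λ θ θ∈Δ → ⊨Γ∪Δ θ (inj₂ θ∈Δ))
sound (Bot φ) M s adm ⊨⊥ = ⊥-elim (⊨⊥ ⊥′ refl)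
sound (AndI φ ψ) M s adm ⊨φψ = ⊨φψ φ (inj₁ refl) , ⊨φψ ψ (inj₂ refl)
sound (AndE₁ φ ψ) M s adm ⊨φ∧ψ = proj₁ (⊨φ∧ψ (φ ∧′ ψ) refl)
sound (AndE₂ φ ψ) M s adm ⊨φ∧ψ = proj₂ (⊨φ∧ψ (φ ∧′ ψ) refl)
sound (Imp0 φ) M s adm _ t _ ⊨φ = ⊨φ
sound (Imp1 Γ φ ψ d) M s adm ⊨ψ⇒Γ t st ⊨ψ =
  sound d M t adm (λ χ χ∈Γ → ⊨ψ⇒Γ (ψ ⇒ χ) (χ , χ∈Γ , refl) t st ⊨ψ)
sound (Imp2 φ ψ χ) M s adm ⊨chain t st ⊨φ =
  ⊨chain (ψ ⇒ χ) (inj₂ refl) t st (⊨chain (φ ⇒ ψ) (inj₁ refl) t st ⊨φ)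
sound (Refl φ ψ refl) M s (_ , reflexive) ⊨φ,φ⇒ψ =
  ⊨φ,φ⇒ψ (φ ⇒ ψ) (inj₂ refl) s (reflexive s) (⊨φ,φ⇒ψ φ (inj₁ refl))
sound {b} (PropM p) M s adm ⊨p t st ⊨ante =
  proposition-contains-reachable-dead-ends (admissible⇒interpretation b adm p)
    (⊨p (var p) refl) st (⊨propAnte⇒dead-end M ⊨ante)

corollary2 : (∀ (Γ : FSet) (φ : Form) → Γ ⊢Kp φ → Γ ⊨Kp φ)
    × (∀ (Γ : FSet) (φ : Form) → Γ ⊢Tp φ → Γ ⊨Tp φ)
corollary2 = (λ Γ φ → sound) , (λ Γ φ → sound)
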